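{- Let $G$ be a finite simple graph of order $n$ and maximum degree $\Delta$. Then $$Mo^\star(G)\leq \left(2\left(\frac{\Delta}{n}\right)^2+\left(\frac{\Delta}{n}\right)-2\left(\frac{\Delta}{n}\right)\sqrt{\left(\frac{\Delta}{n}\right)^2+\left(\frac{\Delta}{n}\right)}\right)n^3.$$
   Context: For a finite simple graph $G$ of order $n$ and a vertex $u$, $d_G(u)$ denotes the degree of $u$ in $G$. The parameter $Mo^\star(G)$ is defined as $Mo^\star(G)=\sum_{uv\in E(G)}\big(n-\min\{d_G(u),d_G(v)\}\big)$, the sum running over all edges $uv$ of $G$. -}

module Defs where

open import Data.Nat using (ℕ; _+_; _*_; _∸_; _⊓_; _⊔_; _≤_; _<ᵇ_)
open import Data.Bool using (Bool; true; false; if_then_else_; _∧_)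
open import Data.Fin using (Fin; toℕ)
open import Data.List using (List; map; foldr; allFin)
open import Data.Nat.ListAction using (sum)
open import Data.Product using (_×_)
open import Relation.Binary.PropositionalEquality using (_≡_)

record Graph (n : ℕ) : Set where
  field
    adj   : Fin n → Fin n → Bool
    sym   : ∀ i j → adj i j ≡ adj j i
    irrefl : ∀ i → adj i i ≡ false
open Graph public

degree : ∀ {n} → Graph n → Fin n → ℕ
degree {n} G i = sum (map (λ j → if adj G i j then 1 else 0) (allFin n))

maxDegree : ∀ {n} → Graph n → ℕ
maxDegree {n} G = foldr _⊔_ 0 (map (degree G) (allFin n))

MoStar : ∀ {n} → Graph n → ℕ
MoStar {n} G =
  sum (map (λ i → sum (map (λ j →
    if adj G i j ∧ (toℕ i <ᵇ toℕ j)
    then n ∸ (degree G i ⊓ degree G j)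
    else 0) (allFin n))) (allFin n))

-- The real-valued inequality
--   M ≤ (2x² + x − 2x√(x² + x)) n³ ,  x = Δ/n
-- equals  M ≤ A − 2Δn·√(Δ² + Δn)  with  A = 2Δ²n + Δn²  (for n > 0; for n = 0 both sides vanish).
-- Since A − 2Δn√(Δ²+Δn) ≥ 0, and all quantities are naturals, this is exactly
--   M ≤ A  and  (2Δn)² (Δ² + Δn) ≤ (A − M)² .
SqrtBound : (n Δ M : ℕ) → Set
SqrtBound n Δ M =
  let A = 2 * Δ * Δ * n + Δ * n * n in
  (M ≤ A) × ((2 * Δ * n) * (2 * Δ * n) * (Δ * Δ + Δ * n) ≤ (A ∸ M) * (A ∸ M))

-- At an edge whose smaller end-degree is δ, put t = δ + Δ and Q = Δ(Δ + n). The identity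
-- (δ + Δ)(n + 2Δ) = δ(n − δ) + t² + Q gives δ(n − δ)/(δ + Δ) = n + 2Δ − (t + Q/t), which is at
-- most R/y := n + 2Δ − (y + Q/y) for an integer y minimising t + Q/t. Hence
-- n − δ ≤ (R/y)(1 + Δ/δ) ≤ (R/y)·Δ·(1/d(u) + 1/d(v)), and since the weights 1/d(u) + 1/d(v)
-- summed over all edges give at most n, Mo*(G) ≤ (R/y)·Δn. Finally y + Q/y ≥ 2√Q by AM-GM, so
-- Mo*(G) ≤ Δn(n + 2Δ − 2√Q), which is the claim. To stay in ℕ, the fractions 1/d are scaled
-- to Δ!/d and the bound on R/y is cross-multiplied.
module Submission where

open import Data.Bool.Base using (Bool; true; false; if_then_else_; _∧_; T)
open import Data.Fin.Base using (Fin; toℕ)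
open import Data.List.Base using (List; []; _∷_; map; foldr; allFin; length)
open import Data.List.Membership.Propositional using (_∈_)
open import Data.List.Membership.Propositional.Properties using (∈-allFin)
open import Data.List.Properties using (length-tabulate)
open import Data.List.Relation.Unary.Any using (here; there)
open import Data.Nat.Base
open import Data.Nat.DivMod using (_/_; m*[n/m]≡n; m/n*n≤m)
open import Data.Nat.Divisibility using (∣-trans; m∣m*n; m≤n⇒m!∣n!)
open import Data.Nat.ListAction using (sum)
open import Data.Nat.Properties
open import Data.Nat.Tactic.RingSolver using (solve-∀)
open import Data.Product.Base using (∃-syntax; _×_; _,_)
open import Data.Sum.Base using (inj₁; inj₂; [_,_]′)
open import Function.Base using (id)
open import Relation.Binary.PropositionalEquality
open import Relation.Nullary.Decidable.Core using (yes; no)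
open import Relation.Nullary.Negation.Core using (contradiction)
open import Algebra.Properties.CommutativeSemigroup +-commutativeSemigroup using (interchange)
open import Defs renaming (sym to adj-sym)

module _ {A : Set} where

  sum-map-cong : {f g : A → ℕ} → (∀ x → f x ≡ g x) → ∀ xs → sum (map f xs) ≡ sum (map g xs)
  sum-map-cong f≡g []       = refl
  sum-map-cong f≡g (x ∷ xs) = cong₂ _+_ (f≡g x) (sum-map-cong f≡g xs)

  sum-map-mono : {f g : A → ℕ} → (∀ x → f x ≤ g x) → ∀ xs → sum (map f xs) ≤ sum (map g xs)
  sum-map-mono f≤g []       = z≤n
  sum-map-mono f≤g (x ∷ xs) = +-mono-≤ (f≤g x) (sum-map-mono f≤g xs)

  sum-map-0 : (xs : List A) → sum (map (λ _ → 0) xs) ≡ 0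
  sum-map-0 []       = refl
  sum-map-0 (x ∷ xs) = sum-map-0 xs

  sum-map-+ : (f g : A → ℕ) → ∀ xs →
              sum (map (λ x → f x + g x) xs) ≡ sum (map f xs) + sum (map g xs)
  sum-map-+ f g []       = refl
  sum-map-+ f g (x ∷ xs) =
    trans (cong (f x + g x +_) (sum-map-+ f g xs)) (interchange (f x) (g x) _ _)

  sum-map-*ˡ : ∀ c (f : A → ℕ) xs → sum (map (λ x → c * f x) xs) ≡ c * sum (map f xs)
  sum-map-*ˡ c f []       = sym (*-zeroʳ c)
  sum-map-*ˡ c f (x ∷ xs) =
    trans (cong (c * f x +_) (sum-map-*ˡ c f xs)) (sym (*-distribˡ-+ c (f x) _))

  sum-map≤length* : {f : A → ℕ} {c : ℕ} → (∀ x → f x ≤ c) → ∀ xs →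
                    sum (map f xs) ≤ length xs * c
  sum-map≤length* f≤c []       = z≤n
  sum-map≤length* f≤c (x ∷ xs) = +-mono-≤ (f≤c x) (sum-map≤length* f≤c xs)

  ∈⇒≤sum-map : (f : A → ℕ) → ∀ {x xs} → x ∈ xs → f x ≤ sum (map f xs)
  ∈⇒≤sum-map f (here refl)            = m≤m+n _ _
  ∈⇒≤sum-map f {xs = y ∷ _} (there p) = ≤-trans (∈⇒≤sum-map f p) (m≤n+m _ (f y))

  ∈⇒≤max-map : (f : A → ℕ) → ∀ {x xs} → x ∈ xs → f x ≤ foldr _⊔_ 0 (map f xs)
  ∈⇒≤max-map f (here refl)            = m≤m⊔n _ _
  ∈⇒≤max-map f {xs = y ∷ _} (there p) = ≤-trans (∈⇒≤max-map f p) (m≤n⊔m (f y) _)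

sum-map-comm : {A B : Set} (f : A → B → ℕ) → ∀ xs ys →
               sum (map (λ x → sum (map (f x) ys)) xs)
               ≡ sum (map (λ y → sum (map (λ x → f x y) xs)) ys)
sum-map-comm f []       ys = sym (sum-map-0 ys)
sum-map-comm f (x ∷ xs) ys =
  trans (cong (sum (map (f x) ys) +_) (sum-map-comm f xs ys))
        (sym (sum-map-+ (f x) (λ y → sum (map (λ x → f x y) xs)) ys))

sumPairs : ∀ {n} → (Fin n → Fin n → ℕ) → ℕ
sumPairs {n} f = sum (map (λ i → sum (map (f i) (allFin n))) (allFin n))

module _ {n : ℕ} where

  sumPairs-cong : {f g : Fin n → Fin n → ℕ} → (∀ i j → f i j ≡ g i j) → sumPairs f ≡ sumPairs g
  sumPairs-cong f≡g = sum-map-cong (λ i → sum-map-cong (f≡g i) (allFin n)) (allFin n)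

  sumPairs-mono : {f g : Fin n → Fin n → ℕ} → (∀ i j → f i j ≤ g i j) → sumPairs f ≤ sumPairs g
  sumPairs-mono f≤g = sum-map-mono (λ i → sum-map-mono (f≤g i) (allFin n)) (allFin n)

  sumPairs-+ : (f g : Fin n → Fin n → ℕ) →
               sumPairs (λ i j → f i j + g i j) ≡ sumPairs f + sumPairs g
  sumPairs-+ f g = trans (sum-map-cong (λ i → sum-map-+ (f i) (g i) (allFin n)) (allFin n))
                         (sum-map-+ _ _ (allFin n))

  sumPairs-*ˡ : ∀ c (f : Fin n → Fin n → ℕ) → sumPairs (λ i j → c * f i j) ≡ c * sumPairs f
  sumPairs-*ˡ c f = trans (sum-map-cong (λ i → sum-map-*ˡ c (f i) (allFin n)) (allFin n))
                          (sum-map-*ˡ c _ (allFin n))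

  sumPairs-transpose : (f : Fin n → Fin n → ℕ) → sumPairs f ≡ sumPairs (λ i j → f j i)
  sumPairs-transpose f = sum-map-comm f (allFin n) (allFin n)

if-then-0-+ : ∀ b x y → (if b then x + y else 0) ≡ (if b then x else 0) + (if b then y else 0)
if-then-0-+ true  x y = refl
if-then-0-+ false x y = refl

if-then-0≡* : ∀ b x → (if b then x else 0) ≡ x * (if b then 1 else 0)
if-then-0≡* true  x = sym (*-identityʳ x)
if-then-0≡* false x = sym (*-zeroʳ x)

m+o≡n+p⇒p≤o⇒m≤n : ∀ {m n o p} → m + o ≡ n + p → p ≤ o → m ≤ n
m+o≡n+p⇒p≤o⇒m≤n {m} {n} {o} eq p≤o =
  +-cancelʳ-≤ o m n (≤-trans (≤-reflexive eq) (+-monoʳ-≤ n p≤o))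

4*[m*n]≤[m+n]*[m+n] : ∀ m n → 4 * (m * n) ≤ (m + n) * (m + n)
4*[m*n]≤[m+n]*[m+n] m n = [ ordered , swapped ]′ (≤-total m n)
  where
  square : ∀ a c → 4 * (a * (a + c)) + c * c ≡ (a + (a + c)) * (a + (a + c))
  square = solve-∀
  ordered : ∀ {a b} → a ≤ b → 4 * (a * b) ≤ (a + b) * (a + b)
  ordered {a} a≤b with m≤n⇒∃[o]m+o≡n a≤b
  ... | c , refl = ≤-trans (m≤m+n _ (c * c)) (≤-reflexive (square a c))
  swapped : n ≤ m → 4 * (m * n) ≤ (m + n) * (m + n)
  swapped n≤m = subst₂ (λ a b → 4 * a ≤ b * b) (*-comm n m) (+-comm n m) (ordered n≤m)

pronic-root : ∀ Q → ∃[ y ] 1 ≤ y × y * y ≤ Q + y × Q ≤ y * y + y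
pronic-root zero    = 1 , ≤-refl , ≤-refl , z≤n
pronic-root (suc Q) with pronic-root Q
... | y , 1≤y , lo , hi with suc Q ≤? y * y + y
... | yes hi′ = y , 1≤y , m≤n⇒m≤1+n lo , hi′
... | no ¬hi′ rewrite ≤-antisym hi (≮⇒≥ ¬hi′) =
  suc y , s≤s z≤n , ≤-trans (m≤m+n _ 1) (≤-reflexive (next-lo y))
                  , ≤-trans (m≤m+n _ _) (≤-reflexive (next-hi y))
  where
  next-lo : ∀ y → suc y * suc y + 1 ≡ suc (y * y + y) + suc y
  next-lo = solve-∀
  next-hi : ∀ y → suc (y * y + y) + suc (y + y) ≡ suc y * suc y + suc y
  next-hi = solve-∀

x+Q/x-cross : ∀ Q s k →
              (s * s + Q) * (s + k) + k * (s * (s + k)) ≡ ((s + k) * (s + k) + Q) * s + k * Q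
x+Q/x-cross = solve-∀

x+Q/x-increasing : ∀ {Q s t} → s ≤ t → Q ≤ s * s + s → (s * s + Q) * t ≤ (t * t + Q) * s
x+Q/x-increasing {Q} {s} s≤t Q≤ with m≤n⇒∃[o]m+o≡n s≤t
... | k , refl = m+o≡n+p⇒p≤o⇒m≤n (x+Q/x-cross Q s k) (k*Q≤ k)
  where
  k*Q≤ : ∀ k → k * Q ≤ k * (s * (s + k))
  k*Q≤ zero    = z≤n
  k*Q≤ (suc k) = *-monoʳ-≤ (suc k) (begin
    Q                   ≤⟨ Q≤ ⟩
    s * s + s           ≤⟨ +-monoʳ-≤ (s * s) (m≤m*n s (suc k)) ⟩
    s * s + s * suc k   ≡⟨ *-distribˡ-+ s s (suc k) ⟨
    s * (s + suc k)     ∎)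
    where open ≤-Reasoning

x+Q/x-decreasing : ∀ {Q s t} → s < t → t * t ≤ Q + t → (t * t + Q) * s ≤ (s * s + Q) * t
x+Q/x-decreasing {Q} {s} s<t t*t≤ with m≤n⇒∃[o]m+o≡n (<⇒≤ s<t)
... | k , refl = m+o≡n+p⇒p≤o⇒m≤n (sym (x+Q/x-cross Q s k)) (*-monoʳ-≤ k s*t≤Q)
  where
  s*t≤Q : s * (s + k) ≤ Q
  s*t≤Q = +-cancelʳ-≤ (s + k) _ Q (begin
    s * (s + k) + (s + k)   ≡⟨ +-comm (s * (s + k)) (s + k) ⟩
    suc s * (s + k)         ≤⟨ *-monoˡ-≤ (s + k) s<t ⟩
    (s + k) * (s + k)       ≤⟨ t*t≤ ⟩
    Q + (s + k)             ∎)
    where open ≤-Reasoning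

pronic-root-minimises : ∀ {Q y} → y * y ≤ Q + y → Q ≤ y * y + y →
                        ∀ t → (y * y + Q) * t ≤ (t * t + Q) * y
pronic-root-minimises {Q} {y} lo hi t with y ≤? t
... | yes y≤t = x+Q/x-increasing y≤t hi
... | no y≰t  = x+Q/x-decreasing (≰⇒> y≰t) lo

radicand : ℕ → ℕ → ℕ
radicand n D = D * D + D * n

square-split : ∀ D δ c →
               δ * c + ((δ + D) * (δ + D) + (D * D + D * (δ + c))) ≡ (δ + D) * ((δ + c) + 2 * D)
square-split = solve-∀

degree-ratio-bound : ∀ {n D y R} → R + (y * y + radicand n D) ≡ (n + 2 * D) * y →
                     (∀ t → (y * y + radicand n D) * t ≤ (t * t + radicand n D) * y) →
                     ∀ δ → δ * (n ∸ δ) * y ≤ (δ + D) * R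
degree-ratio-bound {n} {D} {y} {R} balance minimal δ with δ ≤? n
... | no δ≰n rewrite m≤n⇒m∸n≡0 (<⇒≤ (≰⇒> δ≰n)) | *-zeroʳ δ = z≤n
... | yes δ≤n with m≤n⇒∃[o]m+o≡n δ≤n
... | c , refl rewrite m+n∸m≡n δ c = m+o≡n+p⇒p≤o⇒m≤n split (minimal (δ + D))
  where
  p : ℕ
  p = y * y + radicand (δ + c) D
  split : δ * c * y + ((δ + D) * (δ + D) + radicand (δ + c) D) * y ≡ (δ + D) * R + p * (δ + D)
  split = begin
    δ * c * y + ((δ + D) * (δ + D) + radicand (δ + c) D) * y
      ≡⟨ *-distribʳ-+ y (δ * c) _ ⟨
    (δ * c + ((δ + D) * (δ + D) + radicand (δ + c) D)) * y
      ≡⟨ cong (_* y) (square-split D δ c) ⟩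
    (δ + D) * ((δ + c) + 2 * D) * y
      ≡⟨ *-assoc (δ + D) _ y ⟩
    (δ + D) * (((δ + c) + 2 * D) * y)
      ≡⟨ cong ((δ + D) *_) balance ⟨
    (δ + D) * (R + p)
      ≡⟨ *-distribˡ-+ (δ + D) R p ⟩
    (δ + D) * R + (δ + D) * p
      ≡⟨ cong ((δ + D) * R +_) (*-comm (δ + D) p) ⟩
    (δ + D) * R + p * (δ + D)
      ∎
    where open ≡-Reasoning

optimal-ratio : ∀ n D → .{{NonZero n}} →
                ∃[ y ] ∃[ R ] 1 ≤ y × R + (y * y + radicand n D) ≡ (n + 2 * D) * y
                              × (∀ δ → δ * (n ∸ δ) * y ≤ (δ + D) * R)
optimal-ratio n@(suc _) D with pronic-root (radicand n D)
... | y , 1≤y , lo , hi =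
  y , (n + 2 * D) * y ∸ p , 1≤y , balance , degree-ratio-bound balance minimal
  where
  p : ℕ
  p = y * y + radicand n D
  minimal : ∀ t → p * t ≤ (t * t + radicand n D) * y
  minimal = pronic-root-minimises lo hi
  top-square : ∀ n D y → ((n + D) * (n + D) + (D * D + D * n)) * y ≡ (n + D) * ((n + 2 * D) * y)
  top-square = solve-∀
  p≤ : p ≤ (n + 2 * D) * y
  p≤ = *-cancelˡ-≤ (n + D) (begin
    (n + D) * p                                ≡⟨ *-comm (n + D) p ⟩
    p * (n + D)                                ≤⟨ minimal (n + D) ⟩
    ((n + D) * (n + D) + radicand n D) * y     ≡⟨ top-square n D y ⟩
    (n + D) * ((n + 2 * D) * y)                ∎)
    where open ≤-Reasoning
  balance : (n + 2 * D) * y ∸ p + p ≡ (n + 2 * D) * y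
  balance = m∸n+n≡m p≤

sqrtBound-from-ratio : ∀ n D M y R → 1 ≤ y → R + (y * y + radicand n D) ≡ (n + 2 * D) * y →
                       y * M ≤ R * (D * n) → SqrtBound n D M
sqrtBound-from-ratio n D M y@(suc _) R (s≤s z≤n) balance yM≤RDn = M≤A , square-bound
  where
  A Q p : ℕ
  A = 2 * D * D * n + D * n * n
  Q = radicand n D
  p = y * y + Q
  yM+pDn≤yA : y * M + p * (D * n) ≤ y * A
  yM+pDn≤yA = begin
    y * M + p * (D * n)        ≤⟨ +-monoˡ-≤ (p * (D * n)) yM≤RDn ⟩
    R * (D * n) + p * (D * n)  ≡⟨ *-distribʳ-+ (D * n) R p ⟨
    (R + p) * (D * n)          ≡⟨ cong (_* (D * n)) balance ⟩
    (n + 2 * D) * y * (D * n)  ≡⟨ expand n D y ⟩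
    y * A                      ∎
    where
    open ≤-Reasoning
    expand : ∀ n D y → (n + 2 * D) * y * (D * n) ≡ y * (2 * D * D * n + D * n * n)
    expand = solve-∀
  M≤A : M ≤ A
  M≤A = *-cancelˡ-≤ y (≤-trans (m≤m+n (y * M) _) yM+pDn≤yA)
  pDn≤y[A∸M] : p * (D * n) ≤ y * (A ∸ M)
  pDn≤y[A∸M] = +-cancelˡ-≤ (y * M) _ _ (begin
    y * M + p * (D * n)   ≤⟨ yM+pDn≤yA ⟩
    y * A                 ≡⟨ cong (y *_) (m+[n∸m]≡n M≤A) ⟨
    y * (M + (A ∸ M))     ≡⟨ *-distribˡ-+ y M (A ∸ M) ⟩
    y * M + y * (A ∸ M)   ∎)
    where open ≤-Reasoning
  square-bound : (2 * D * n) * (2 * D * n) * Q ≤ (A ∸ M) * (A ∸ M)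
  square-bound = *-cancelˡ-≤ (y * y) (begin
    y * y * ((2 * D * n) * (2 * D * n) * Q)
      ≡⟨ regroup D n y Q ⟩
    (D * n) * (D * n) * (4 * (y * y * Q))
      ≤⟨ *-monoʳ-≤ ((D * n) * (D * n)) (4*[m*n]≤[m+n]*[m+n] (y * y) Q) ⟩
    (D * n) * (D * n) * (p * p)
      ≡⟨ square-*′ (D * n) p ⟩
    (p * (D * n)) * (p * (D * n))
      ≤⟨ *-mono-≤ pDn≤y[A∸M] pDn≤y[A∸M] ⟩
    (y * (A ∸ M)) * (y * (A ∸ M))
      ≡⟨ square-* y (A ∸ M) ⟨
    y * y * ((A ∸ M) * (A ∸ M))
      ∎)
    where
    open ≤-Reasoning
    regroup : ∀ D n y Q →
              y * y * ((2 * D * n) * (2 * D * n) * Q) ≡ (D * n) * (D * n) * (4 * (y * y * Q))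
    regroup = solve-∀
    square-* : ∀ a b → a * a * (b * b) ≡ (a * b) * (a * b)
    square-* = solve-∀
    square-*′ : ∀ a b → a * a * (b * b) ≡ (b * a) * (b * a)
    square-*′ = solve-∀

-- F/k, with the junk value 0 at k = 0: isolated vertices lie on no edge and need no weight.
share : (F k : ℕ) → ℕ
share F zero    = 0
share F (suc k) = F / suc k

*-share≤ : ∀ F k → k * share F k ≤ F
*-share≤ F zero    = z≤n
*-share≤ F (suc k) = subst (_≤ F) (*-comm (F / suc k) (suc k)) (m/n*n≤m F (suc k))

*-share-! : ∀ {k m} → 1 ≤ k → k ≤ m → k * share (m !) k ≡ m !
*-share-! {suc k} _ k≤m = m*[n/m]≡n (∣-trans (m∣m*n (k !)) (m≤n⇒m!∣n! k≤m))

edge-term-bound : ∀ {n D y R F δ e u v} → δ * (n ∸ δ) * y ≤ (δ + D) * R →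
                  δ * u ≡ F → e * v ≡ F → e ≤ D → y * F * (n ∸ δ) ≤ R * D * (u + v)
edge-term-bound {n} {D} {y} {R} {F} {δ} {e} {u} {v} ratio δu≡F ev≡F e≤D = begin
  y * F * (n ∸ δ)         ≡⟨ cong (λ x → y * x * (n ∸ δ)) δu≡F ⟨
  y * (δ * u) * (n ∸ δ)   ≡⟨ regroup y δ u (n ∸ δ) ⟩
  u * (δ * (n ∸ δ) * y)   ≤⟨ *-monoʳ-≤ u ratio ⟩
  u * ((δ + D) * R)       ≡⟨ distribute u δ D R ⟩
  R * (δ * u + D * u)     ≡⟨ cong (λ x → R * (x + D * u)) (trans δu≡F (sym ev≡F)) ⟩
  R * (e * v + D * u)     ≤⟨ *-monoʳ-≤ R (+-monoˡ-≤ (D * u) (*-monoˡ-≤ v e≤D)) ⟩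
  R * (D * v + D * u)     ≡⟨ collect R D u v ⟩
  R * D * (u + v)         ∎
  where
  open ≤-Reasoning
  regroup : ∀ y δ u x → y * (δ * u) * x ≡ u * (δ * x * y)
  regroup = solve-∀
  distribute : ∀ u δ D R → u * ((δ + D) * R) ≡ R * (δ * u + D * u)
  distribute = solve-∀
  collect : ∀ R D u v → R * (D * v + D * u) ≡ R * D * (u + v)
  collect = solve-∀

module _ {n : ℕ} (G : Graph n) where

  isEdge : Fin n → Fin n → Bool
  isEdge i j = adj G i j ∧ (toℕ i <ᵇ toℕ j)

  degree≤maxDegree : ∀ i → degree G i ≤ maxDegree G
  degree≤maxDegree i = ∈⇒≤max-map (degree G) (∈-allFin i)

  adj⇒1≤degree : ∀ {i j} → adj G i j ≡ true → 1 ≤ degree G i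
  adj⇒1≤degree {i} {j} i~j =
    subst (λ b → (if b then 1 else 0) ≤ degree G i) i~j (∈⇒≤sum-map _ (∈-allFin j))

  isEdge-at-most-once : ∀ i j x →
    (if isEdge i j then x else 0) + (if isEdge j i then x else 0) ≤ (if adj G i j then x else 0)
  isEdge-at-most-once i j x rewrite adj-sym G j i with adj G i j
  ... | false = z≤n
  ... | true with toℕ i <ᵇ toℕ j in i<j | toℕ j <ᵇ toℕ i in j<i
  ... | true  | true  = contradiction (<ᵇ⇒< (toℕ j) (toℕ i) (subst T (sym j<i) _))
                                     (<⇒≯ (<ᵇ⇒< (toℕ i) (toℕ j) (subst T (sym i<j) _)))
  ... | true  | false = ≤-reflexive (+-identityʳ x)
  ... | false | true  = ≤-refl
  ... | false | false = z≤n

  weighted-handshake : (w : Fin n → ℕ) →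
                       sumPairs (λ i j → if isEdge i j then w i + w j else 0)
                       ≤ sum (map (λ i → w i * degree G i) (allFin n))
  weighted-handshake w = begin
    sumPairs (λ i j → if isEdge i j then w i + w j else 0)
      ≡⟨ sumPairs-cong (λ i j → if-then-0-+ (isEdge i j) (w i) (w j)) ⟩
    sumPairs (λ i j → tail i j + head i j)
      ≡⟨ sumPairs-+ tail head ⟩
    sumPairs tail + sumPairs head
      ≡⟨ cong (sumPairs tail +_) (sumPairs-transpose head) ⟩
    sumPairs tail + sumPairs (λ i j → head j i)
      ≡⟨ sumPairs-+ tail (λ i j → head j i) ⟨
    sumPairs (λ i j → tail i j + head j i)
      ≤⟨ sumPairs-mono (λ i j → isEdge-at-most-once i j (w i)) ⟩
    sumPairs (λ i j → if adj G i j then w i else 0)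
      ≡⟨ sum-map-cong weighted-degree (allFin n) ⟩
    sum (map (λ i → w i * degree G i) (allFin n))
      ∎
    where
    open ≤-Reasoning
    tail head : Fin n → Fin n → ℕ
    tail i j = if isEdge i j then w i else 0
    head i j = if isEdge i j then w j else 0
    weighted-degree : ∀ i →
      sum (map (λ j → if adj G i j then w i else 0) (allFin n)) ≡ w i * degree G i
    weighted-degree i = trans (sum-map-cong (λ j → if-then-0≡* (adj G i j) (w i)) (allFin n))
                              (sum-map-*ˡ (w i) _ (allFin n))

  MoStar-bound : ∀ y R → (∀ δ → δ * (n ∸ δ) * y ≤ (δ + maxDegree G) * R) →
                 y * MoStar G ≤ R * (maxDegree G * n)
  MoStar-bound y R ratio = *-cancelˡ-≤ F {{Δ !≢0}} (begin
    F * (y * MoStar G)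
      ≡⟨ regroup F y (MoStar G) ⟩
    y * F * MoStar G
      ≡⟨ sumPairs-*ˡ (y * F) term ⟨
    sumPairs (λ i j → y * F * term i j)
      ≤⟨ sumPairs-mono term-bound ⟩
    sumPairs (λ i j → R * Δ * edgeWeight i j)
      ≡⟨ sumPairs-*ˡ (R * Δ) edgeWeight ⟩
    R * Δ * sumPairs edgeWeight
      ≤⟨ *-monoʳ-≤ (R * Δ) (weighted-handshake w) ⟩
    R * Δ * sum (map (λ i → w i * d i) (allFin n))
      ≤⟨ *-monoʳ-≤ (R * Δ) (sum-map≤length* w*d≤F (allFin n)) ⟩
    R * Δ * (length (allFin n) * F)
      ≡⟨ cong (λ m → R * Δ * (m * F)) (length-tabulate {n = n} id) ⟩
    R * Δ * (n * F)
      ≡⟨ collect R Δ n F ⟩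
    F * (R * (Δ * n))
      ∎)
    where
    open ≤-Reasoning
    Δ F : ℕ
    Δ = maxDegree G
    F = Δ !
    d w : Fin n → ℕ
    d = degree G
    w i = share F (d i)
    term edgeWeight : Fin n → Fin n → ℕ
    term i j = if isEdge i j then n ∸ (d i ⊓ d j) else 0
    edgeWeight i j = if isEdge i j then w i + w j else 0
    w*d≤F : ∀ i → w i * d i ≤ F
    w*d≤F i = subst (_≤ F) (*-comm (d i) (w i)) (*-share≤ F (d i))
    d*w≡F : ∀ {i j} → adj G i j ≡ true → d i * w i ≡ F
    d*w≡F i~j = *-share-! (adj⇒1≤degree i~j) (degree≤maxDegree _)
    term-bound : ∀ i j → y * F * term i j ≤ R * Δ * edgeWeight i j
    term-bound i j with adj G i j in i~j | toℕ i <ᵇ toℕ j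
    ... | false | _     rewrite *-zeroʳ (y * F) = z≤n
    ... | true  | false rewrite *-zeroʳ (y * F) = z≤n
    ... | true  | true with ⊓-sel (d i) (d j)
    ... | inj₁ min≡dᵢ rewrite min≡dᵢ =
      edge-term-bound {δ = d i} {u = w i} (ratio (d i)) (d*w≡F i~j) (d*w≡F j~i) (degree≤maxDegree j)
      where
      j~i : adj G j i ≡ true
      j~i = trans (adj-sym G j i) i~j
    ... | inj₂ min≡dⱼ rewrite min≡dⱼ | +-comm (w i) (w j) =
      edge-term-bound {δ = d j} {u = w j} (ratio (d j)) (d*w≡F j~i) (d*w≡F i~j) (degree≤maxDegree i)
      where
      j~i : adj G j i ≡ true
      j~i = trans (adj-sym G j i) i~j
    regroup : ∀ F y M → F * (y * M) ≡ y * F * M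
    regroup = solve-∀
    collect : ∀ R Δ n F → R * Δ * (n * F) ≡ F * (R * (Δ * n))
    collect = solve-∀

theorem2 : (n : ℕ) (G : Graph n) → SqrtBound n (maxDegree G) (MoStar G)
theorem2 zero      G = z≤n , z≤n
theorem2 n@(suc _) G =
  let y , R , 1≤y , balance , ratio = optimal-ratio n (maxDegree G)
  in sqrtBound-from-ratio n (maxDegree G) (MoStar G) y R 1≤y balance (MoStar-bound G y R ratio)
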